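{- Let $\varphi(x;\overline{y})$ be a partitioned formula, $B \subseteq \mathfrak{C}^{\mathrm{lg}(\overline{y})}$ finite, $p\in S_\varphi(B)$, and let $\mathcal{B}$ be a nonempty set of subsets of $B$. Let $\overline{b}\in B$, let $B_0\in\mathcal{B}$ be $\le_p$-minimal in $\mathcal{B}$, and let $\overline{b}'\in B_0$. Suppose that (i) $p_{B_0,\{\overline{b}'\}}$ is consistent and decides $\varphi(x;\overline{b})$, (ii) $p_{B_0}$ does not decide $\varphi(x;\overline{b})$, and (iii) there exists $B_1 \le_p B_0 - \{\overline{b}'\}$ such that $B_1\cup\{\overline{b}\}\in\mathcal{B}$. Then $p_{B_0,\{\overline{b}'\}}$ decides $\varphi(x;\overline{b})$ correctly.
   Context: Work in a monster model $\mathfrak{C}$ of a complete theory $T$. $\theta^1=\theta$, $\theta^0=\neg\theta$. For $p\in S_\varphi(B)$ (a maximal consistent set of formulas $\varphi(x;\overline{b})^t$, $\overline{b}\in B$, $t<2$) let $\delta:B\to 2$ be the function with $\varphi(x;\overline{b})^{\delta(\overline{b})}\in p$. For $B_1\subseteq B_0\subseteq B$: $p_{B_0}=\{\varphi(x;\overline{b})^{\delta(\overline{b})}:\overline{b}\in B_0\}$ (with $p_\emptyset = \{x=x\}$), and $p_{B_0,B_1}=\{\varphi(x;\overline{b})^{\delta(\overline{b})}:\overline{b}\in B_0-B_1\}\cup\{\neg\varphi(x;\overline{b})^{\delta(\overline{b})}:\overline{b}\in B_1\}$ (not necessarily consistent). A set of formulas $q(x)$ decides $\varphi(x;\overline{b})$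 if $q\vdash\varphi(x;\overline{b})$ or $q\vdash\neg\varphi(x;\overline{b})$; it decides it correctly if $q\vdash\varphi(x;\overline{b})^{\delta(\overline{b})}$. For $B_0,B_1\subseteq B$, $B_0\le_p B_1$ means $p_{B_0}(x)\vdash p_{B_1}(x)$; $B_0\equiv_p B_1$ means both $B_0 \le_p B_1$ and $B_1\le_p B_0$. $B_0\in\mathcal{B}$ is $\le_p$-minimal in $\mathcal{B}$ if for every $B_2\in\mathcal{B}$, $B_2\le_p B_0$ implies $B_2\equiv_p B_0$. -}

module Defs where

-- The monster model is represented by
--   X : the set of tuples of length lg(x) from the monster model,
--   Y : the set of tuples of length lg(ȳ) from the monster model,
--   φ : X → Y → Bool, the truth value of φ(a ; b̄) in the monster model.
-- A finite parameter set B ⊆ Y is given by an injective enumeration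
-- Bs : Fin n → Y; subsets of B are subsets of the index set (Subset n).
-- Since every set of formulas occurring here is a finite set of instances of
-- φ / ¬φ with parameters in the monster model, consistency = realised in the
-- monster model, and q ⊢ ψ  =  every realisation of q satisfies ψ.

open import Data.Bool using (Bool; not; true; false)
open import Data.Nat using (ℕ)
open import Data.Fin using (Fin)
open import Data.Fin.Subset using (Subset; _∈_; _∉_)
open import Data.Product using (_×_; Σ; ∃; _,_)
open import Data.Sum using (_⊎_)
open import Relation.Binary.PropositionalEquality using (_≡_)

-- A set of φ-literals over B: a predicate on pairs (index i, sign t),
-- the pair (i , t) standing for φ(x ; b̄ᵢ)^t  (φ^true = φ, φ^false = ¬φ).
LitSet : ℕ → Set₁
LitSet n = Fin n → Bool → Set

module _ {X Y : Set} (φ : X → Y → Bool) {n : ℕ} (Bs : Fin n → Y) where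

  Realises : X → LitSet n → Set
  Realises a q = ∀ i t → q i t → φ a (Bs i) ≡ t

  Consistent : LitSet n → Set
  Consistent q = Σ X λ a → Realises a q

  Entails : LitSet n → Fin n → Bool → Set
  Entails q i t = ∀ a → Realises a q → φ a (Bs i) ≡ t

  Decides : LitSet n → Fin n → Set
  Decides q i = Entails q i true ⊎ Entails q i false

  -- p ∈ S_φ(B), encoded by its sign function δ : B → 2:
  -- p = { φ(x ; b̄)^{δ(b̄)} : b̄ ∈ B }, which must be consistent.
  IsφType : (Fin n → Bool) → Set
  IsφType δ = Σ X λ a → ∀ i → φ a (Bs i) ≡ δ i

  module _ (δ : Fin n → Bool) where

    DecidesCorrectly : LitSet n → Fin n → Set
    DecidesCorrectly q i = Entails q i (δ i)

    pOf : Subset n → LitSet n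
    pOf B₀ i t = i ∈ B₀ × t ≡ δ i

    pOf₂ : Subset n → Subset n → LitSet n
    pOf₂ B₀ B₁ i t = (i ∈ B₀ × i ∉ B₁ × t ≡ δ i) ⊎ (i ∈ B₁ × t ≡ not (δ i))

    _≤p_ : Subset n → Subset n → Set
    B₀ ≤p B₁ = ∀ i t → pOf B₁ i t → Entails (pOf B₀) i t

    _≡p_ : Subset n → Subset n → Set
    B₀ ≡p B₁ = B₀ ≤p B₁ × B₁ ≤p B₀

    Minimal : (Subset n → Set) → Subset n → Set
    Minimal 𝓑 B₀ = 𝓑 B₀ × (∀ B₂ → 𝓑 B₂ → B₂ ≤p B₀ → B₂ ≡p B₀)

-- If p_{B₀,{b̄′}} decided φ(x ; b̄) wrongly, every realisation of p_{B₁ ∪ {b̄}} would have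
-- to satisfy φ(x ; b̄′)^{δ(b̄′)} (otherwise it realises p_{B₀,{b̄′}} and gets b̄ wrong), so
-- B₁ ∪ {b̄} ≤_p B₀. Minimality of B₀ then gives B₀ ≤_p B₁ ∪ {b̄}, i.e. p_{B₀} decides
-- φ(x ; b̄) after all.
module Submission where

open import Defs
open import Data.Bool using (Bool; true; false; not)
open import Data.Bool.Properties using (not-¬; ¬-not) renaming (_≟_ to _≟ᵇ_)
open import Data.Empty using (⊥-elim)
open import Data.Nat using (ℕ)
open import Data.Fin using (Fin; _≟_)
open import Data.Fin.Subset using (Subset; _∈_; _⊆_; _∪_; ⁅_⁆; _-_)
open import Data.Fin.Subset.Properties
  using (x∈⁅x⁆; x∈⁅y⁆⇒x≡y; p⊆p∪q; q⊆p∪q; x∈p∧x≢y⇒x∈p-y; x∈p∧x∉q⇒x∈p─q)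
open import Data.Product using (_×_; Σ; _,_; proj₂)
open import Data.Sum using (_⊎_; inj₁; inj₂)
open import Function.Definitions using (Injective)
open import Relation.Binary.PropositionalEquality using (_≡_; _≢_; refl)
open import Relation.Nullary using (¬_; yes; no)

module _ {X Y : Set} (φ : X → Y → Bool) {n : ℕ} (Bs : Fin n → Y) (δ : Fin n → Bool) where

  private
    _⊨_ : X → LitSet n → Set
    _⊨_ = Realises φ Bs

    p : Subset n → LitSet n
    p = pOf φ Bs δ

    p₂ : Subset n → Subset n → LitSet n
    p₂ = pOf₂ φ Bs δ

    _≤ₚ_ : Subset n → Subset n → Set
    _≤ₚ_ = _≤p_ φ Bs δ

  entails⇒decides : ∀ {q i} t → Entails φ Bs q i t → Decides φ Bs q i
  entails⇒decides true  = inj₁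
  entails⇒decides false = inj₂

  decides⇒correctly⊎wrongly : ∀ {q i} → Decides φ Bs q i →
    DecidesCorrectly φ Bs δ q i ⊎ Entails φ Bs q i (not (δ i))
  decides⇒correctly⊎wrongly {i = i} dec with δ i | dec
  ... | true  | d = d
  ... | false | inj₁ e = inj₂ e
  ... | false | inj₂ e = inj₁ e

  realises-⊆ : ∀ {a B B′} → B ⊆ B′ → a ⊨ p B′ → a ⊨ p B
  realises-⊆ B⊆B′ r i t (i∈B , t≡) = r i t (B⊆B′ i∈B , t≡)

  ≤p⇒realises : ∀ {a B B′} → B ≤ₚ B′ → a ⊨ p B → a ⊨ p B′
  ≤p⇒realises B≤B′ r i t i∈ = B≤B′ i t i∈ _ r

  realises⇒≤p : ∀ {B B′} → (∀ a → a ⊨ p B → a ⊨ p B′) → B ≤ₚ B′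
  realises⇒≤p h i t i∈ a r = h a r i t i∈

  ≤p-entails : ∀ {B B′ i} → B ≤ₚ B′ → i ∈ B′ → Entails φ Bs (p B) i (δ i)
  ≤p-entails B≤B′ i∈B′ = B≤B′ _ _ (i∈B′ , refl)

  realises-p₂-⁅⁆ : ∀ {a B₀ b′} → a ⊨ p (B₀ - b′) → φ a (Bs b′) ≢ δ b′ → a ⊨ p₂ B₀ ⁅ b′ ⁆
  realises-p₂-⁅⁆ r _ j _ (inj₁ (j∈B₀ , j∉⁅b′⁆ , refl)) = r j _ (x∈p∧x∉q⇒x∈p─q j∈B₀ j∉⁅b′⁆ , refl)
  realises-p₂-⁅⁆ {b′ = b′} _ ≢δ j _ (inj₂ (j∈⁅b′⁆ , refl)) with x∈⁅y⁆⇒x≡y b′ j∈⁅b′⁆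
  ... | refl = ¬-not ≢δ

  wrong-decision⇒∪⁅⁆≤p : ∀ {B₀ B₁ b b′} → B₁ ≤ₚ (B₀ - b′) →
    Entails φ Bs (p₂ B₀ ⁅ b′ ⁆) b (not (δ b)) → (B₁ ∪ ⁅ b ⁆) ≤ₚ B₀
  wrong-decision⇒∪⁅⁆≤p {B₀} {B₁} {b} {b′} B₁≤ wrong = realises⇒≤p realises-B₀
    where
    realises-B₀-b′ : ∀ {a} → a ⊨ p (B₁ ∪ ⁅ b ⁆) → a ⊨ p (B₀ - b′)
    realises-B₀-b′ r = ≤p⇒realises B₁≤ (realises-⊆ (p⊆p∪q _) r)

    realises-B₀ : ∀ a → a ⊨ p (B₁ ∪ ⁅ b ⁆) → a ⊨ p B₀
    realises-B₀ a r i _ (i∈B₀ , refl) with i ≟ b′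
    ... | no i≢b′ = realises-B₀-b′ r i _ (x∈p∧x≢y⇒x∈p-y i∈B₀ i≢b′ , refl)
    ... | yes refl with φ a (Bs b′) ≟ᵇ δ b′
    ...   | yes correct = correct
    ...   | no ≢δ = ⊥-elim (not-¬ b-correct (wrong a flipped))
      where
      b-correct : φ a (Bs b) ≡ δ b
      b-correct = realises-⊆ (q⊆p∪q B₁ _) r b _ (x∈⁅x⁆ b , refl)

      flipped : a ⊨ p₂ B₀ ⁅ b′ ⁆
      flipped = realises-p₂-⁅⁆ (realises-B₀-b′ r) ≢δ

lemma3p10 : {X Y : Set} (φ : X → Y → Bool) (n : ℕ) (Bs : Fin n → Y)
    → Injective _≡_ _≡_ Bs
    → (δ : Fin n → Bool) → IsφType φ Bs δ
    → (𝓑 : Subset n → Set) → Σ (Subset n) 𝓑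
    → (b : Fin n) (B₀ : Subset n) → Minimal φ Bs δ 𝓑 B₀
    → (b′ : Fin n) → b′ ∈ B₀
    → Consistent φ Bs (pOf₂ φ Bs δ B₀ ⁅ b′ ⁆)
    → Decides φ Bs (pOf₂ φ Bs δ B₀ ⁅ b′ ⁆) b
    → ¬ Decides φ Bs (pOf φ Bs δ B₀) b
    → (Σ (Subset n) λ B₁ → _≤p_ φ Bs δ B₁ (B₀ - b′) × 𝓑 (B₁ ∪ ⁅ b ⁆))
    → DecidesCorrectly φ Bs δ (pOf₂ φ Bs δ B₀ ⁅ b′ ⁆) b
lemma3p10 φ n Bs _ δ _ 𝓑 _ b B₀ (_ , minimal) b′ _ _ dec ¬dec (B₁ , B₁≤ , B₁∪⁅b⁆∈𝓑)
  with decides⇒correctly⊎wrongly φ Bs δ dec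
... | inj₁ correct = correct
... | inj₂ wrong = ⊥-elim (¬dec (entails⇒decides φ Bs δ (δ b) (≤p-entails φ Bs δ B₀≤ b∈B₁∪⁅b⁆)))
  where
  B₀≤ : _≤p_ φ Bs δ B₀ (B₁ ∪ ⁅ b ⁆)
  B₀≤ = proj₂ (minimal _ B₁∪⁅b⁆∈𝓑 (wrong-decision⇒∪⁅⁆≤p φ Bs δ B₁≤ wrong))

  b∈B₁∪⁅b⁆ : b ∈ B₁ ∪ ⁅ b ⁆
  b∈B₁∪⁅b⁆ = q⊆p∪q B₁ _ (x∈⁅x⁆ b)
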